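{- Let $c,r,n$ be positive integers with $2<r<2c$. Then $R^c(B^rK_n)\ge 1+c\left\lfloor \frac{n-2}{c-1}\right\rfloor$.
   Context: An $r$-uniform hypergraph ($r$-graph) consists of a vertex set and a set of $r$-element subsets of it (hyperedges); $\mathcal{K}_N^r$ denotes the complete $r$-graph on $N$ vertices and $K_n$ the complete graph on $n$ vertices. For a graph $F$, an $r$-graph $\mathcal{H}$ contains a Berge-$F$ if there are an injection $\varphi:V(F)\to V(\mathcal{H})$ and an injection $f$ from $E(F)$ to the hyperedges of $\mathcal{H}$ with $\{\varphi(x),\varphi(y)\}\subseteq f(xy)$ for every edge $xy$; $B^rF$ is the family of $r$-uniform Berge copies of $F$. A $c$-coloring assigns to each hyperedge one of the colors $1,\dots,c$. $R^c(B^rK_n)$ is the smallest $N$ such that in every $c$-coloring of $\mathcal{K}_N^r$ the hyperedges of some single color contain a Berge-$K_n$. -}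

module Defs where

open import Data.Nat using (ℕ; zero; suc; _+_; _*_; _∸_; _/_; _<_)
open import Data.Fin using (Fin) renaming (_<_ to _<ᶠ_)
open import Data.Fin.Subset using (Subset; _∈_; ∣_∣)
open import Data.Product using (Σ; ∃; _×_; _,_)
open import Relation.Binary.PropositionalEquality using (_≡_)
open import Relation.Nullary using (¬_)
open import Function.Definitions using (Injective)

-- Hyperedges of the complete r-graph K_N^r are the subsets e of Fin N with ∣ e ∣ ≡ r.
-- A c-coloring of K_N^r: a map from subsets of Fin N to colours Fin c
-- (only its values on r-subsets matter; every colouring of the r-subsets
-- extends to such a map and each such map restricts to one).
Coloring : ℕ → ℕ → Set
Coloring c N = Subset N → Fin c

BergeKnInColor : (c r n N : ℕ) → Coloring c N → Fin c → Set
BergeKnInColor c r n N χ i =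
  Σ (Fin n → Fin N) λ φ →
  Σ ((x y : Fin n) → x <ᶠ y → Subset N) λ f →
    Injective _≡_ _≡_ φ
    × (∀ x y x' y' (p : x <ᶠ y) (p' : x' <ᶠ y') →
         f x y p ≡ f x' y' p' → (x ≡ x' × y ≡ y'))
    × (∀ x y (p : x <ᶠ y) →
         (∣ f x y p ∣ ≡ r) × (χ (f x y p) ≡ i)
         × (φ x ∈ f x y p) × (φ y ∈ f x y p))

RamseyProp : (c r n N : ℕ) → Set
RamseyProp c r n N = (χ : Coloring c N) → ∃ λ i → BergeKnInColor c r n N χ i

RamseyAtLeast : (c r n L : ℕ) → Set
RamseyAtLeast c r n L = ∀ N → N < L → ¬ RamseyProp c r n N

-- floor division, with the (irrelevant here) convention a / 0 = 0
floorDiv : ℕ → ℕ → ℕ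
floorDiv a zero = 0
floorDiv a (suc b) = a / suc b

-- Split the N vertices into c classes of size m = ⌊(n-2)/(c-1)⌋ and give each
-- r-edge a colour i whose class it meets at most once; some colour works because
-- r < 2c. A Berge-K_n of colour i has two of its vertices in every one of its
-- edges, so at most one of its vertices lies in class i and the others are spread
-- over the remaining c-1 classes: n ≤ 1 + (c-1)m ≤ n-1.
module Submission where

open import Defs
open import Data.Nat using (ℕ; _+_; _*_; _∸_; _<_; _≤_; zero; suc; z≤n; s≤s⁻¹)
open import Data.Nat.Properties using (≤-pred; <-≤-trans; <⇒≱; n≮0; n≮n; *-comm; *-zeroʳ)
open import Data.Nat.DivMod using (_/_; m/n*n≤m; 0/n≡0)
open import Data.Fin using (Fin; zero; suc; combine; punchOut) renaming (_<_ to _<ᶠ_)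
open import Data.Fin.Properties
  using (_≟_; any?; suc-injective; 0≢1+n; injective⇒≤; inject≤-injective; *↔×;
         combine-injective; punchOut-injective; <-cmp; <⇒≢; toℕ<n)
open import Data.Fin.Subset using (Subset; _∈_; ∣_∣; inside; outside)
open import Data.Fin.Subset.Properties using (_∈?_)
open import Data.Vec.Base using (_∷_; here; there)
open import Data.Product using (∃₂; _×_; _,_; proj₁; proj₂)
open import Data.Product.Properties using (×-≡,≡→≡)
open import Data.Empty using (⊥; ⊥-elim)
open import Function using (_∘_)
open import Function.Bundles using (_↣_; mk↣; Injection)
open import Function.Construct.Composition using (_↣-∘_)
open import Function.Definitions using (Injective)
open import Function.Properties.Inverse using (↔⇒↣)
open import Relation.Binary using (tri<; tri≈; tri>)
open import Relation.Binary.PropositionalEquality using (_≡_; _≢_; refl; sym; trans; cong; subst)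
open import Relation.Nullary using (¬_; Dec; yes; no; ¬?; contradiction)
open import Relation.Nullary.Decidable using (_×-dec_; decidable-stable)

n*⌊m/n⌋≤m : ∀ m n → n * floorDiv m n ≤ m
n*⌊m/n⌋≤m m zero    = z≤n
n*⌊m/n⌋≤m m (suc n) = subst (_≤ m) (*-comm (m / suc n) (suc n)) (m/n*n≤m m (suc n))

⌊0/n⌋≡0 : ∀ n → floorDiv 0 n ≡ 0
⌊0/n⌋≡0 zero    = refl
⌊0/n⌋≡0 (suc n) = 0/n≡0 (suc n)

rank : ∀ {N} {v : Fin N} (p : Subset N) → v ∈ p → Fin ∣ p ∣
rank (inside  ∷ p) here        = zero
rank (inside  ∷ p) (there v∈p) = suc (rank p v∈p)
rank (outside ∷ p) (there v∈p) = rank p v∈p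

rank-injective : ∀ {N} (p : Subset N) {u v : Fin N} (u∈p : u ∈ p) (v∈p : v ∈ p) →
  rank p u∈p ≡ rank p v∈p → u ≡ v
rank-injective (inside  ∷ p) here        here        _  = refl
rank-injective (inside  ∷ p) (there u∈p) (there v∈p) eq =
  cong suc (rank-injective p u∈p v∈p (suc-injective eq))
rank-injective (outside ∷ p) (there u∈p) (there v∈p) eq =
  cong suc (rank-injective p u∈p v∈p eq)

injective⇒≤∣p∣ : ∀ {k N} (p : Subset N) {f : Fin k → Fin N} → Injective _≡_ _≡_ f →
  (∀ x → f x ∈ p) → k ≤ ∣ p ∣
injective⇒≤∣p∣ p f-inj f∈p = injective⇒≤ (f-inj ∘ rank-injective p (f∈p _) (f∈p _))

partition : ∀ {N c m} → N ≤ c * m → Fin N ↣ (Fin c × Fin m)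
partition N≤cm = ↔⇒↣ *↔× ↣-∘ mk↣ (inject≤-injective N≤cm N≤cm _ _)

injective-meeting-class-once⇒≤ : ∀ {n c m} {ψ : Fin n → Fin (suc c) × Fin m} →
  Injective _≡_ _≡_ ψ → (i : Fin (suc c)) →
  (∀ x y → proj₁ (ψ x) ≡ i → proj₁ (ψ y) ≡ i → x ≡ y) → n ≤ suc (c * m)
injective-meeting-class-once⇒≤ {n} {c} {m} {ψ} ψ-inj i once = injective⇒≤ squeeze-injective
  where
  squeeze : Fin n → Fin (suc (c * m))
  squeeze x with proj₁ (ψ x) ≟ i
  ... | yes _  = zero
  ... | no  x≢ = suc (combine (punchOut (x≢ ∘ sym)) (proj₂ (ψ x)))

  squeeze-injective : Injective _≡_ _≡_ squeeze
  squeeze-injective {x} {y} eq with proj₁ (ψ x) ≟ i | proj₁ (ψ y) ≟ i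
  ... | yes x∈i | yes y∈i = once x y x∈i y∈i
  ... | yes _   | no  _   = contradiction eq 0≢1+n
  ... | no  _   | yes _   = contradiction (sym eq) 0≢1+n
  ... | no  x≢  | no  y≢  with combine-injective _ _ _ _ (suc-injective eq)
  ...   | same-class , same-offset =
    ψ-inj (×-≡,≡→≡ (punchOut-injective (x≢ ∘ sym) (y≢ ∘ sym) same-class , same-offset))

module ClassColouring {N c m : ℕ} (ι : Fin N ↣ (Fin (suc c) × Fin m)) where
  open Injection ι using (to; injective)

  class : Fin N → Fin (suc c)
  class = proj₁ ∘ to

  Crowded : Fin (suc c) → Subset N → Set
  Crowded i e = ∃₂ λ u v → u ∈ e × v ∈ e × class u ≡ i × class v ≡ i × u ≢ v

  crowded? : ∀ i e → Dec (Crowded i e)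
  crowded? i e = any? λ u → any? λ v →
    (u ∈? e) ×-dec (v ∈? e) ×-dec (class u ≟ i) ×-dec (class v ≟ i) ×-dec ¬? (u ≟ v)

  everywhere-crowded⇒≤∣e∣ : ∀ e → (∀ i → Crowded i e) → 2 * suc c ≤ ∣ e ∣
  everywhere-crowded⇒≤∣e∣ e crowded =
    injective⇒≤∣p∣ e (split-injective ∘ pick-injective) (pick∈e ∘ split)
    where
    open Injection (↔⇒↣ (*↔× {2} {suc c}))
      using () renaming (to to split; injective to split-injective)

    pick : Fin 2 × Fin (suc c) → Fin N
    pick (zero  , i) = proj₁ (crowded i)
    pick (suc _ , i) = proj₁ (proj₂ (crowded i))

    pick∈e : ∀ a → pick a ∈ e
    pick∈e (zero  , i) = let (_ , _ , u∈e , _) = crowded i in u∈e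
    pick∈e (suc _ , i) = let (_ , _ , _ , v∈e , _) = crowded i in v∈e

    class-pick : ∀ a → class (pick a) ≡ proj₂ a
    class-pick (zero  , i) = let (_ , _ , _ , _ , u∈i , _) = crowded i in u∈i
    class-pick (suc _ , i) = let (_ , _ , _ , _ , _ , v∈i , _) = crowded i in v∈i

    pick-distinct : ∀ i → pick (zero , i) ≢ pick (suc zero , i)
    pick-distinct i = let (_ , _ , _ , _ , _ , _ , u≢v) = crowded i in u≢v

    row-injective : ∀ i {a b} → pick (a , i) ≡ pick (b , i) → a ≡ b
    row-injective i {zero}     {zero}     _  = refl
    row-injective i {zero}     {suc zero} eq = contradiction eq (pick-distinct i)
    row-injective i {suc zero} {zero}     eq = contradiction (sym eq) (pick-distinct i)
    row-injective i {suc zero} {suc zero} _  = refl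

    pick-injective : Injective _≡_ _≡_ pick
    pick-injective {a , i} {b , j} eq
      with refl ← trans (sym (class-pick (a , i))) (trans (cong class eq) (class-pick (b , j)))
      = cong (_, i) (row-injective i eq)

  colour : Coloring (suc c) N
  colour e with any? (λ i → ¬? (crowded? i e))
  ... | yes (i , _) = i
  ... | no  _       = zero

  colour-uncrowded : ∀ e → ∣ e ∣ < 2 * suc c → ¬ Crowded (colour e) e
  colour-uncrowded e small with any? (λ i → ¬? (crowded? i e))
  ... | yes (_ , uncrowded) = uncrowded
  ... | no  none = contradiction
    (everywhere-crowded⇒≤∣e∣ e λ i → decidable-stable (crowded? i e) (none ∘ (i ,_)))
    (<⇒≱ small)

  monochromatic-Berge⇒≤ : ∀ {r n i} → r < 2 * suc c →
    BergeKnInColor (suc c) r n N colour i → n ≤ suc (c * m)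
  monochromatic-Berge⇒≤ {i = i} r<2c (φ , f , φ-inj , _ , edge) =
    injective-meeting-class-once⇒≤ (φ-inj ∘ injective) i once
    where
    edge-uncrowded : ∀ {x y} → x <ᶠ y → class (φ x) ≡ i → class (φ y) ≡ i → ⊥
    edge-uncrowded {x} {y} x<y x∈i y∈i with edge x y x<y
    ... | ∣f∣≡r , colour≡i , φx∈f , φy∈f =
      subst (λ j → ¬ Crowded j (f x y x<y)) colour≡i
        (colour-uncrowded (f x y x<y) (subst (_< 2 * suc c) (sym ∣f∣≡r) r<2c))
        (φ x , φ y , φx∈f , φy∈f , x∈i , y∈i , <⇒≢ x<y ∘ φ-inj)

    once : ∀ x y → class (φ x) ≡ i → class (φ y) ≡ i → x ≡ y
    once x y x∈i y∈i with <-cmp x y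
    ... | tri< x<y _ _ = ⊥-elim (edge-uncrowded x<y x∈i y∈i)
    ... | tri≈ _ x≡y _ = x≡y
    ... | tri> _ _ y<x = ⊥-elim (edge-uncrowded y<x y∈i x∈i)

theorem3 : (c r n : ℕ) → 0 < c → 0 < r → 0 < n → 2 < r → r < 2 * c →
    RamseyAtLeast c r n (1 + c * floorDiv (n ∸ 2) (c ∸ 1))
theorem3 zero    _ _ () _ _ _ _
theorem3 _       _ zero _ _ () _ _
theorem3 (suc c) _ 1 _ _ _ _ _ N N<L ramsey =
  n≮0 (<-≤-trans (toℕ<n (proj₁ (proj₂ (ramsey (λ _ → zero))) zero)) N≤0)
  where
  N≤0 : N ≤ 0
  N≤0 = subst (N ≤_) (trans (cong (suc c *_) (⌊0/n⌋≡0 c)) (*-zeroʳ (suc c))) (≤-pred N<L)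
theorem3 (suc c) r (suc (suc k)) _ _ _ _ r<2c N N<L ramsey =
  n≮n k (<-≤-trans (s≤s⁻¹ berge-bound) (n*⌊m/n⌋≤m k c))
  where
  open ClassColouring (partition {N} {suc c} {floorDiv k c} (≤-pred N<L))
  berge-bound : suc (suc k) ≤ suc (c * floorDiv k c)
  berge-bound = let (i , berge) = ramsey colour in monochromatic-Berge⇒≤ r<2c berge
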